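{- Let $L$ be a BL-algebra and order the set $M_L$ of good sequences componentwise ($\mathbf{a}\le\mathbf{b}$ iff $a_i\le b_i$ for all $i$). Then $(M_L,\le)$ is a lattice, and for all $\mathbf{a},\mathbf{b}\in M_L$: $\mathbf{a}\vee\mathbf{b}=(a_1\vee b_1,a_2\vee b_2,\ldots)$ and $\mathbf{a}\wedge\mathbf{b}=(a_1\wedge b_1,a_2\wedge b_2,\ldots)$.
   Context: A BL-algebra is an algebra $(L,\wedge,\vee,\otimes,\to,0,1)$ such that $(L,\wedge,\vee,0,1)$ is a bounded lattice, $(L,\otimes,1)$ is a commutative monoid, $x\otimes y\le z$ iff $x\le y\to z$, $x\wedge y=x\otimes(x\to y)$, and $(x\to y)\vee(y\to x)=1$. Put $\bar x=x\to0$, $x\oslash y=\bar x\to y$, $x+y=(x\oslash y)\wedge(y\oslash x)$. A good sequence of $L$ is a sequence $(a_1,a_2,\ldots)$ in $L$ with $a_i+a_{i+1}=a_i$ for all $i$ and $a_r=0$ for all large $r$; $M_L$ denotes the set of good sequences. -}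

module Defs where

open import Level using (Level; suc; _⊔_)
open import Data.Nat using (ℕ) renaming (suc to sucℕ; _≤_ to _≤ℕ_)
open import Data.Product using (Σ; ∃; _×_; _,_; proj₁)
open import Relation.Binary.PropositionalEquality using (_≡_)
open import Relation.Binary.Structures using (IsPartialOrder)

record BLAlgebra (c : Level) : Set (suc c) where
  infixr 6 _∨_
  infixr 7 _∧_
  infixr 7 _⊗_
  infixr 5 _⇒_
  infix 4 _≤_
  field
    Carrier : Set c
    _∧_ _∨_ _⊗_ _⇒_ : Carrier → Carrier → Carrier
    𝟘 𝟙 : Carrier

  _≤_ : Carrier → Carrier → Set c
  x ≤ y = x ∧ y ≡ x

  field
    ∧-comm   : ∀ x y → x ∧ y ≡ y ∧ x
    ∨-comm   : ∀ x y → x ∨ y ≡ y ∨ x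
    ∧-assoc  : ∀ x y z → (x ∧ y) ∧ z ≡ x ∧ (y ∧ z)
    ∨-assoc  : ∀ x y z → (x ∨ y) ∨ z ≡ x ∨ (y ∨ z)
    ∧-absorbs-∨ : ∀ x y → x ∧ (x ∨ y) ≡ x
    ∨-absorbs-∧ : ∀ x y → x ∨ (x ∧ y) ≡ x
    𝟘-least    : ∀ x → 𝟘 ≤ x
    𝟙-greatest : ∀ x → x ≤ 𝟙
    ⊗-comm   : ∀ x y → x ⊗ y ≡ y ⊗ x
    ⊗-assoc  : ∀ x y z → (x ⊗ y) ⊗ z ≡ x ⊗ (y ⊗ z)
    ⊗-identityʳ : ∀ x → x ⊗ 𝟙 ≡ x
    residuated₁ : ∀ x y z → x ⊗ y ≤ z → x ≤ y ⇒ z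
    residuated₂ : ∀ x y z → x ≤ y ⇒ z → x ⊗ y ≤ z
    divisibility : ∀ x y → x ∧ y ≡ x ⊗ (x ⇒ y)
    prelinearity : ∀ x y → (x ⇒ y) ∨ (y ⇒ x) ≡ 𝟙

  ¬_ : Carrier → Carrier
  ¬ x = x ⇒ 𝟘

  _⊘_ : Carrier → Carrier → Carrier
  x ⊘ y = (¬ x) ⇒ y

  _⊕_ : Carrier → Carrier → Carrier
  x ⊕ y = (x ⊘ y) ∧ (y ⊘ x)

  -- sequences (a₁, a₂, …) are functions ℕ → L; index 0 stands for a₁
  Seq : Set c
  Seq = ℕ → Carrier

  IsGood : Seq → Set c
  IsGood a = (∀ i → a i ⊕ a (sucℕ i) ≡ a i)
           × ∃ λ n → ∀ r → n ≤ℕ r → a r ≡ 𝟘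

  M : Set c
  M = Σ Seq IsGood

  _≤M_ : M → M → Set c
  a ≤M b = ∀ i → proj₁ a i ≤ proj₁ b i

  _≈M_ : M → M → Set c
  a ≈M b = ∀ i → proj₁ a i ≡ proj₁ b i

  _∨ₛ_ : Seq → Seq → Seq
  (a ∨ₛ b) i = a i ∨ b i

  _∧ₛ_ : Seq → Seq → Seq
  (a ∧ₛ b) i = a i ∧ b i

  IsSupM : M → M → M → Set c
  IsSupM a b j = a ≤M j × b ≤M j × (∀ c → a ≤M c → b ≤M c → j ≤M c)

  IsInfM : M → M → M → Set c
  IsInfM a b m = m ≤M a × m ≤M b × (∀ c → c ≤M a → c ≤M b → c ≤M m)

module Submission where

-- The whole proof rests on one characterisation of the defining condition
-- x ⊕ y = x of a good sequence (covers⇒absorbs and absorbs⇒covers):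
--
--     x ⊕ y = x   iff   1 ≤ x ∨ ¬y .
--
-- The "if" direction is a short residuation argument.  The "only if"
-- direction first turns x ⊕ y ≤ x into ¬x ≤ ¬x ⊗ ¬y (via De Morgan and
-- ¬(a ⇒ b) ≤ ¬¬a ⊗ ¬b), deduces that ¬x and y are disjoint, and concludes
-- with prelinearity.  The covering condition 1 ≤ x ∨ ¬y is visibly stable
-- under joins and meets of pairs (expand the product of two covers of 1), so
-- good sequences are closed under componentwise ∨ and ∧; these are then the
-- least upper and greatest lower bounds because ∨ and ∧ are those of L.

open import Level using (Level)
open import Data.Nat using (_⊔_) renaming (_≤_ to _≤ℕ_)
open import Data.Nat.Properties using (m≤m⊔n; m≤n⊔m) renaming (≤-trans to ≤ℕ-trans)
open import Data.Product using (Σ; ∃; _×_; _,_; proj₁)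
open import Relation.Binary.Bundles using (Poset)
open import Relation.Binary.Structures using (IsPartialOrder)
open import Relation.Binary.PropositionalEquality
  using (_≡_; refl; sym; trans; cong; cong₂; isEquivalence)
open import Algebra.Lattice.Bundles using (Lattice)
import Algebra.Lattice.Properties.Lattice as LatticeProperties
import Relation.Binary.Lattice as OrderTheoretic
open import Defs

module BLProperties {c : Level} (L : BLAlgebra c) where
  open BLAlgebra L

  lattice : Lattice c c
  lattice = record
    { Carrier = Carrier ; _≈_ = _≡_ ; _∨_ = _∨_ ; _∧_ = _∧_
    ; isLattice = record
      { isEquivalence = isEquivalence
      ; ∨-comm = ∨-comm ; ∨-assoc = ∨-assoc ; ∨-cong = cong₂ _∨_
      ; ∧-comm = ∧-comm ; ∧-assoc = ∧-assoc ; ∧-cong = cong₂ _∧_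
      ; absorptive = ∨-absorbs-∧ , ∧-absorbs-∨
      }
    }

  open LatticeProperties lattice public using (∧-idem; ∨-idem)
  open LatticeProperties lattice using (∨-∧-orderTheoreticLattice)
  -- The library orders a lattice by x ≡ x ∧ y, the symmetric reading of
  -- L's x ∧ y ≡ x; every order fact below is transported along sym.
  private
    module Ord = OrderTheoretic.Lattice ∨-∧-orderTheoreticLattice

  ≤-isPartialOrder : IsPartialOrder _≡_ _≤_
  ≤-isPartialOrder = record
    { isPreorder = record
      { isEquivalence = isEquivalence
      ; reflexive = λ x≡y → sym (Ord.reflexive x≡y)
      ; trans = λ x≤y y≤z → sym (Ord.trans (sym x≤y) (sym y≤z))
      }
    ; antisym = λ x≤y y≤x → Ord.antisym (sym x≤y) (sym y≤x)
    }

  poset : Poset c c c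
  poset = record { isPartialOrder = ≤-isPartialOrder }

  open Poset poset public using (reflexive; antisym) renaming (refl to ≤-refl; trans to ≤-trans)
  open import Relation.Binary.Reasoning.PartialOrder poset public

  x∧y≤x : ∀ x y → x ∧ y ≤ x
  x∧y≤x x y = sym (Ord.x∧y≤x x y)

  x∧y≤y : ∀ x y → x ∧ y ≤ y
  x∧y≤y x y = sym (Ord.x∧y≤y x y)

  ∧-greatest : ∀ {x y z} → x ≤ y → x ≤ z → x ≤ y ∧ z
  ∧-greatest x≤y x≤z = sym (Ord.∧-greatest (sym x≤y) (sym x≤z))

  x≤x∨y : ∀ x y → x ≤ x ∨ y
  x≤x∨y x y = sym (Ord.x≤x∨y x y)

  y≤x∨y : ∀ x y → y ≤ x ∨ y
  y≤x∨y x y = sym (Ord.y≤x∨y x y)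

  ∨-least : ∀ {x y z} → x ≤ z → y ≤ z → x ∨ y ≤ z
  ∨-least x≤z y≤z = sym (Ord.∨-least (sym x≤z) (sym y≤z))

  ∨-mono : ∀ {a b d e} → a ≤ b → d ≤ e → a ∨ d ≤ b ∨ e
  ∨-mono a≤b d≤e = ∨-least (≤-trans a≤b (x≤x∨y _ _)) (≤-trans d≤e (y≤x∨y _ _))

  -- The following facts hold in every commutative integral residuated lattice;
  -- divisibility and prelinearity are used only from `factor` onwards.

  ⊗-monoˡ : ∀ {a b} z → a ≤ b → a ⊗ z ≤ b ⊗ z
  ⊗-monoˡ {a} {b} z a≤b = residuated₂ a z (b ⊗ z) (≤-trans a≤b (residuated₁ b z (b ⊗ z) ≤-refl))

  ⊗-monoʳ : ∀ {a b} z → a ≤ b → z ⊗ a ≤ z ⊗ b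
  ⊗-monoʳ {a} {b} z a≤b = begin
    z ⊗ a  ≡⟨ ⊗-comm z a ⟩
    a ⊗ z  ≤⟨ ⊗-monoˡ z a≤b ⟩
    b ⊗ z  ≡⟨ ⊗-comm b z ⟩
    z ⊗ b  ∎

  ⊗-mono : ∀ {a b d e} → a ≤ b → d ≤ e → a ⊗ d ≤ b ⊗ e
  ⊗-mono {e = e} a≤b d≤e = ≤-trans (⊗-monoʳ _ d≤e) (⊗-monoˡ e a≤b)

  mp : ∀ a b → a ⊗ (a ⇒ b) ≤ b
  mp a b = ≤-trans (reflexive (⊗-comm a (a ⇒ b))) (residuated₂ (a ⇒ b) a b ≤-refl)

  -- L is integral (1 is the top), so ⊗ lies below both factors and below ∧.
  x⊗y≤x : ∀ x y → x ⊗ y ≤ x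
  x⊗y≤x x y = ≤-trans (⊗-monoʳ x (𝟙-greatest y)) (reflexive (⊗-identityʳ x))

  x⊗y≤y : ∀ x y → x ⊗ y ≤ y
  x⊗y≤y x y = ≤-trans (reflexive (⊗-comm x y)) (x⊗y≤x y x)

  x⊗y≤x∧y : ∀ x y → x ⊗ y ≤ x ∧ y
  x⊗y≤x∧y x y = ∧-greatest (x⊗y≤x x y) (x⊗y≤y x y)

  -- ⊗ distributes over ∨: to bound (a ∨ b) ⊗ d it suffices to bound
  -- a ⊗ d and b ⊗ d, since both a and b lie below d ⇒ R.
  ⊗-∨-leastˡ : ∀ {a b d R} → a ⊗ d ≤ R → b ⊗ d ≤ R → (a ∨ b) ⊗ d ≤ R
  ⊗-∨-leastˡ {a} {b} {d} {R} ad≤R bd≤R =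
    residuated₂ (a ∨ b) d R (∨-least (residuated₁ a d R ad≤R) (residuated₁ b d R bd≤R))

  ⊗-∨-leastʳ : ∀ {a b d R} → d ⊗ a ≤ R → d ⊗ b ≤ R → d ⊗ (a ∨ b) ≤ R
  ⊗-∨-leastʳ {a} {b} {d} {R} da≤R db≤R = begin
    d ⊗ (a ∨ b)  ≡⟨ ⊗-comm d (a ∨ b) ⟩
    (a ∨ b) ⊗ d  ≤⟨ ⊗-∨-leastˡ (≤-trans (reflexive (⊗-comm a d)) da≤R)
                              (≤-trans (reflexive (⊗-comm b d)) db≤R) ⟩
    R            ∎

  x⊗¬x≤𝟘 : ∀ x → x ⊗ ¬ x ≤ 𝟘
  x⊗¬x≤𝟘 x = mp x 𝟘

  ¬x⊗x≤𝟘 : ∀ x → ¬ x ⊗ x ≤ 𝟘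
  ¬x⊗x≤𝟘 x = ≤-trans (reflexive (⊗-comm (¬ x) x)) (x⊗¬x≤𝟘 x)

  ¬a≤a⇒b : ∀ a b → ¬ a ≤ a ⇒ b
  ¬a≤a⇒b a b = residuated₁ (¬ a) a b (≤-trans (¬x⊗x≤𝟘 a) (𝟘-least b))

  a≤¬a⇒b : ∀ a b → a ≤ ¬ a ⇒ b
  a≤¬a⇒b a b = residuated₁ a (¬ a) b (≤-trans (x⊗¬x≤𝟘 a) (𝟘-least b))

  ¬-antitone : ∀ {a b} → a ≤ b → ¬ b ≤ ¬ a
  ¬-antitone {a} {b} a≤b = residuated₁ (¬ b) a 𝟘 (≤-trans (⊗-monoʳ (¬ b) a≤b) (¬x⊗x≤𝟘 b))

  ¬¬-intro : ∀ x → x ≤ ¬ ¬ x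
  ¬¬-intro x = residuated₁ x (¬ x) 𝟘 (x⊗¬x≤𝟘 x)

  ¬¬¬-elim : ∀ x → ¬ ¬ ¬ x ≤ ¬ x
  ¬¬¬-elim x = ¬-antitone (¬¬-intro x)

  ¬a⊗¬b≤¬[a∨b] : ∀ a b → ¬ a ⊗ ¬ b ≤ ¬ (a ∨ b)
  ¬a⊗¬b≤¬[a∨b] a b = residuated₁ (¬ a ⊗ ¬ b) (a ∨ b) 𝟘 (⊗-∨-leastʳ
    (≤-trans (⊗-monoˡ a (x⊗y≤x (¬ a) (¬ b))) (¬x⊗x≤𝟘 a))
    (≤-trans (⊗-monoˡ b (x⊗y≤y (¬ a) (¬ b))) (¬x⊗x≤𝟘 b)))

  a⊗[a⇒b]≡a∧b : ∀ a b → a ⊗ (a ⇒ b) ≡ a ∧ b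
  a⊗[a⇒b]≡a∧b a b = sym (divisibility a b)

  factor : ∀ {a b} → b ≤ a → a ⊗ (a ⇒ b) ≡ b
  factor {a} {b} b≤a = trans (a⊗[a⇒b]≡a∧b a b) (trans (∧-comm a b) b≤a)

  by-prelinearity : ∀ {z R} a b → z ⊗ (a ⇒ b) ≤ R → z ⊗ (b ⇒ a) ≤ R → z ≤ R
  by-prelinearity {z} {R} a b case₁ case₂ = begin
    z                              ≡⟨ sym (⊗-identityʳ z) ⟩
    z ⊗ 𝟙                          ≡⟨ cong (z ⊗_) (sym (prelinearity a b)) ⟩
    z ⊗ ((a ⇒ b) ∨ (b ⇒ a))        ≤⟨ ⊗-∨-leastʳ case₁ case₂ ⟩
    R                              ∎

  -- ¬(a ⇒ b) ≤ ¬¬a ⊗ ¬b: the case a ⇒ b is trivial; in the case b ⇒ a we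
  -- factor s = ¬(a ⇒ b) through ¬¬a (it lies below it) and check that the
  -- cofactor annihilates b.
  ¬[a⇒b]≤¬¬a⊗¬b : ∀ a b → ¬ (a ⇒ b) ≤ ¬ ¬ a ⊗ ¬ b
  ¬[a⇒b]≤¬¬a⊗¬b a b = by-prelinearity a b
    (≤-trans (¬x⊗x≤𝟘 (a ⇒ b)) (𝟘-least _))
    (begin
      s ⊗ (b ⇒ a)              ≡⟨ cong (_⊗ (b ⇒ a)) (sym (factor s≤n)) ⟩
      (n ⊗ (n ⇒ s)) ⊗ (b ⇒ a)  ≡⟨ ⊗-assoc n (n ⇒ s) (b ⇒ a) ⟩
      n ⊗ ((n ⇒ s) ⊗ (b ⇒ a))  ≤⟨ ⊗-monoʳ n (residuated₁ _ b 𝟘 cofactor-kills-b) ⟩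
      n ⊗ ¬ b                  ∎)
    where
      s n : Carrier
      s = ¬ (a ⇒ b)
      n = ¬ ¬ a
      s≤n : s ≤ n
      s≤n = ¬-antitone (¬a≤a⇒b a b)
      cofactor-kills-b : ((n ⇒ s) ⊗ (b ⇒ a)) ⊗ b ≤ 𝟘
      cofactor-kills-b = begin
        ((n ⇒ s) ⊗ (b ⇒ a)) ⊗ b   ≡⟨ ⊗-assoc (n ⇒ s) (b ⇒ a) b ⟩
        (n ⇒ s) ⊗ ((b ⇒ a) ⊗ b)   ≡⟨ cong ((n ⇒ s) ⊗_) (begin-equality
            (b ⇒ a) ⊗ b              ≡⟨ ⊗-comm (b ⇒ a) b ⟩
            b ⊗ (b ⇒ a)              ≡⟨ a⊗[a⇒b]≡a∧b b a ⟩
            b ∧ a                    ≡⟨ ∧-comm b a ⟩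
            a ∧ b                    ≡⟨ divisibility a b ⟩
            a ⊗ (a ⇒ b)              ∎) ⟩
        (n ⇒ s) ⊗ (a ⊗ (a ⇒ b))   ≤⟨ ⊗-monoʳ (n ⇒ s) (⊗-monoˡ (a ⇒ b) (¬¬-intro a)) ⟩
        (n ⇒ s) ⊗ (n ⊗ (a ⇒ b))   ≡⟨ sym (⊗-assoc (n ⇒ s) n (a ⇒ b)) ⟩
        ((n ⇒ s) ⊗ n) ⊗ (a ⇒ b)   ≤⟨ ⊗-monoˡ (a ⇒ b) (≤-trans (reflexive (⊗-comm (n ⇒ s) n)) (mp n s)) ⟩
        s ⊗ (a ⇒ b)               ≤⟨ ¬x⊗x≤𝟘 (a ⇒ b) ⟩
        𝟘                         ∎

  -- The same for x ⊘ y = ¬x ⇒ y, where the triple negation collapses.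
  ¬[x⊘y]≤¬x⊗¬y : ∀ x y → ¬ (x ⊘ y) ≤ ¬ x ⊗ ¬ y
  ¬[x⊘y]≤¬x⊗¬y x y = ≤-trans (¬[a⇒b]≤¬¬a⊗¬b (¬ x) y) (⊗-monoˡ (¬ y) (¬¬¬-elim x))

  ¬[a∧b]≤¬a∨¬b : ∀ a b → ¬ (a ∧ b) ≤ ¬ a ∨ ¬ b
  ¬[a∧b]≤¬a∨¬b a b = by-prelinearity a b
    (≤-trans (¬[a∧b]⊗[a⇒b]≤¬a a b) (x≤x∨y (¬ a) (¬ b)))
    (≤-trans (reflexive (cong (λ m → ¬ m ⊗ (b ⇒ a)) (∧-comm a b)))
             (≤-trans (¬[a∧b]⊗[a⇒b]≤¬a b a) (y≤x∨y (¬ a) (¬ b))))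
    where
      -- ¬(u ∧ v) ⊗ (u ⇒ v) refutes u, because u ⊗ (u ⇒ v) = u ∧ v.
      ¬[a∧b]⊗[a⇒b]≤¬a : ∀ u v → ¬ (u ∧ v) ⊗ (u ⇒ v) ≤ ¬ u
      ¬[a∧b]⊗[a⇒b]≤¬a u v = residuated₁ _ u 𝟘 (begin
        (¬ (u ∧ v) ⊗ (u ⇒ v)) ⊗ u  ≡⟨ ⊗-assoc (¬ (u ∧ v)) (u ⇒ v) u ⟩
        ¬ (u ∧ v) ⊗ ((u ⇒ v) ⊗ u)  ≡⟨ cong (¬ (u ∧ v) ⊗_) (trans (⊗-comm (u ⇒ v) u) (a⊗[a⇒b]≡a∧b u v)) ⟩
        ¬ (u ∧ v) ⊗ (u ∧ v)        ≤⟨ ¬x⊗x≤𝟘 (u ∧ v) ⟩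
        𝟘                          ∎)

  absorbing-meet : ∀ {a b} z → a ≤ a ⊗ b → a ∧ z ≤ b ⊗ z
  absorbing-meet {a} {b} z a≤ab = begin
    a ∧ z              ≡⟨ divisibility a z ⟩
    a ⊗ (a ⇒ z)        ≤⟨ ⊗-monoˡ (a ⇒ z) a≤ab ⟩
    (a ⊗ b) ⊗ (a ⇒ z)  ≡⟨ trans (cong (_⊗ (a ⇒ z)) (⊗-comm a b)) (⊗-assoc b a (a ⇒ z)) ⟩
    b ⊗ (a ⊗ (a ⇒ z))  ≤⟨ ⊗-monoʳ b (mp a z) ⟩
    b ⊗ z              ∎

  disjoint⇒[a⇒b≤¬a] : ∀ {a b} → a ∧ b ≤ 𝟘 → a ⇒ b ≤ ¬ a
  disjoint⇒[a⇒b≤¬a] {a} {b} a∧b≤𝟘 = residuated₁ (a ⇒ b) a 𝟘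
    (≤-trans (reflexive (trans (⊗-comm (a ⇒ b) a) (a⊗[a⇒b]≡a∧b a b))) a∧b≤𝟘)

  disjoint⇒cover : ∀ {a b} → a ∧ b ≤ 𝟘 → 𝟙 ≤ ¬ a ∨ ¬ b
  disjoint⇒cover {a} {b} a∧b≤𝟘 = begin
    𝟙                    ≡⟨ sym (prelinearity a b) ⟩
    (a ⇒ b) ∨ (b ⇒ a)    ≤⟨ ∨-mono (disjoint⇒[a⇒b≤¬a] a∧b≤𝟘)
                                   (disjoint⇒[a⇒b≤¬a] (≤-trans (reflexive (∧-comm b a)) a∧b≤𝟘)) ⟩
    ¬ a ∨ ¬ b            ∎

  x⇒¬y≤y⇒¬x : ∀ x y → x ⇒ ¬ y ≤ y ⇒ ¬ x
  x⇒¬y≤y⇒¬x x y = residuated₁ (x ⇒ ¬ y) y (¬ x) (residuated₁ _ x 𝟘 (begin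
    ((x ⇒ ¬ y) ⊗ y) ⊗ x   ≡⟨ trans (⊗-assoc (x ⇒ ¬ y) y x) (cong ((x ⇒ ¬ y) ⊗_) (⊗-comm y x)) ⟩
    (x ⇒ ¬ y) ⊗ (x ⊗ y)   ≡⟨ trans (sym (⊗-assoc (x ⇒ ¬ y) x y)) (cong (_⊗ y) (⊗-comm (x ⇒ ¬ y) x)) ⟩
    (x ⊗ (x ⇒ ¬ y)) ⊗ y   ≤⟨ ⊗-monoˡ y (mp x (¬ y)) ⟩
    ¬ y ⊗ y               ≤⟨ ¬x⊗x≤𝟘 y ⟩
    𝟘                     ∎))

  Absorbs : Carrier → Carrier → Set c
  Absorbs x y = x ⊕ y ≡ x

  Covers : Carrier → Carrier → Set c
  Covers x y = 𝟙 ≤ x ∨ ¬ y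

  x≤x⊕y : ∀ x y → x ≤ x ⊕ y
  x≤x⊕y x y = ∧-greatest (a≤¬a⇒b x y) (residuated₁ x (¬ y) x (x⊗y≤x x (¬ y)))

  covers⇒absorbs : ∀ {x y} → Covers x y → Absorbs x y
  covers⇒absorbs {x} {y} cover = antisym x⊕y≤x (x≤x⊕y x y)
    where
      W = x ⊕ y
      x⊕y≤x : W ≤ x
      x⊕y≤x = begin
        W                ≡⟨ sym (⊗-identityʳ W) ⟩
        W ⊗ 𝟙            ≤⟨ ⊗-monoʳ W cover ⟩
        W ⊗ (x ∨ ¬ y)    ≤⟨ ⊗-∨-leastʳ (x⊗y≤y W x) (begin
            W ⊗ ¬ y          ≤⟨ ⊗-monoˡ (¬ y) (x∧y≤y (x ⊘ y) (y ⊘ x)) ⟩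
            (y ⊘ x) ⊗ ¬ y    ≡⟨ ⊗-comm (y ⊘ x) (¬ y) ⟩
            ¬ y ⊗ (y ⊘ x)    ≤⟨ mp (¬ y) x ⟩
            x                ∎) ⟩
        x                ∎

  -- From x ⊕ y ≤ x: first ¬x ≤ ¬x ⊗ ¬y, so ¬x and y are disjoint; this
  -- gives 1 ≤ ¬¬x ∨ ¬y, and prelinearity shows ¬¬x ≤ x ∨ ¬y.
  absorbs⇒covers : ∀ {x y} → Absorbs x y → Covers x y
  absorbs⇒covers {x} {y} x⊕y≡x = begin
    𝟙               ≤⟨ disjoint⇒cover ¬x∧y≤𝟘 ⟩
    ¬ ¬ x ∨ ¬ y     ≤⟨ ∨-least ¬¬x≤x∨¬y (y≤x∨y x (¬ y)) ⟩
    x ∨ ¬ y         ∎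
    where
      ¬x≤¬x⊗¬y : ¬ x ≤ ¬ x ⊗ ¬ y
      ¬x≤¬x⊗¬y = begin
        ¬ x                          ≤⟨ ¬-antitone (reflexive x⊕y≡x) ⟩
        ¬ ((x ⊘ y) ∧ (y ⊘ x))        ≤⟨ ¬[a∧b]≤¬a∨¬b (x ⊘ y) (y ⊘ x) ⟩
        ¬ (x ⊘ y) ∨ ¬ (y ⊘ x)        ≤⟨ ∨-least (¬[x⊘y]≤¬x⊗¬y x y)
                                        (≤-trans (¬[x⊘y]≤¬x⊗¬y y x) (reflexive (⊗-comm (¬ y) (¬ x)))) ⟩
        ¬ x ⊗ ¬ y                    ∎
      ¬x∧y≤𝟘 : ¬ x ∧ y ≤ 𝟘
      ¬x∧y≤𝟘 = ≤-trans (absorbing-meet y ¬x≤¬x⊗¬y) (¬x⊗x≤𝟘 y)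
      ¬¬x≤x∨¬y : ¬ ¬ x ≤ x ∨ ¬ y
      ¬¬x≤x∨¬y = by-prelinearity (¬ y) x
        (begin
          ¬ ¬ x ⊗ (y ⊘ x)        ≤⟨ x⊗y≤x∧y (¬ ¬ x) (y ⊘ x) ⟩
          ¬ ¬ x ∧ (y ⊘ x)        ≤⟨ ∧-greatest (≤-trans (x∧y≤x _ _) (¬a≤a⇒b (¬ x) y)) (x∧y≤y _ _) ⟩
          x ⊕ y                  ≡⟨ x⊕y≡x ⟩
          x                      ≤⟨ x≤x∨y x (¬ y) ⟩
          x ∨ ¬ y                ∎)
        (begin
          ¬ ¬ x ⊗ (x ⇒ ¬ y)      ≤⟨ x⊗y≤y (¬ ¬ x) (x ⇒ ¬ y) ⟩
          x ⇒ ¬ y                ≤⟨ x⇒¬y≤y⇒¬x x y ⟩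
          y ⇒ ¬ x                ≤⟨ disjoint⇒[a⇒b≤¬a] (≤-trans (reflexive (∧-comm y (¬ x))) ¬x∧y≤𝟘) ⟩
          ¬ y                    ≤⟨ y≤x∨y x (¬ y) ⟩
          x ∨ ¬ y                ∎)

  cover-product : ∀ {a₁ b₁ a₂ b₂ R} → 𝟙 ≤ a₁ ∨ b₁ → 𝟙 ≤ a₂ ∨ b₂
                → a₁ ⊗ a₂ ≤ R → a₁ ⊗ b₂ ≤ R → b₁ ⊗ a₂ ≤ R → b₁ ⊗ b₂ ≤ R → 𝟙 ≤ R
  cover-product {a₁} {b₁} {a₂} {b₂} {R} cover₁ cover₂ p q r s = begin
    𝟙                      ≡⟨ sym (⊗-identityʳ 𝟙) ⟩
    𝟙 ⊗ 𝟙                  ≤⟨ ⊗-mono cover₁ cover₂ ⟩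
    (a₁ ∨ b₁) ⊗ (a₂ ∨ b₂)  ≤⟨ ⊗-∨-leastʳ (⊗-∨-leastˡ p r) (⊗-∨-leastˡ q s) ⟩
    R                      ∎

  covers-∨ : ∀ {x₁ y₁ x₂ y₂} → Covers x₁ y₁ → Covers x₂ y₂ → Covers (x₁ ∨ x₂) (y₁ ∨ y₂)
  covers-∨ {x₁} {y₁} {x₂} {y₂} cover₁ cover₂ = cover-product cover₁ cover₂
    (≤-trans (x⊗y≤x x₁ x₂) x₁≤R)
    (≤-trans (x⊗y≤x x₁ (¬ y₂)) x₁≤R)
    (≤-trans (x⊗y≤y (¬ y₁) x₂) x₂≤R)
    (≤-trans (¬a⊗¬b≤¬[a∨b] y₁ y₂) (y≤x∨y (x₁ ∨ x₂) _))
    where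
      x₁≤R : x₁ ≤ (x₁ ∨ x₂) ∨ ¬ (y₁ ∨ y₂)
      x₁≤R = ≤-trans (x≤x∨y x₁ x₂) (x≤x∨y _ _)
      x₂≤R : x₂ ≤ (x₁ ∨ x₂) ∨ ¬ (y₁ ∨ y₂)
      x₂≤R = ≤-trans (y≤x∨y x₁ x₂) (x≤x∨y _ _)

  covers-∧ : ∀ {x₁ y₁ x₂ y₂} → Covers x₁ y₁ → Covers x₂ y₂ → Covers (x₁ ∧ x₂) (y₁ ∧ y₂)
  covers-∧ {x₁} {y₁} {x₂} {y₂} cover₁ cover₂ = cover-product cover₁ cover₂
    (≤-trans (x⊗y≤x∧y x₁ x₂) (x≤x∨y _ _))
    (≤-trans (x⊗y≤y x₁ (¬ y₂)) ¬y₂≤R)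
    (≤-trans (x⊗y≤x (¬ y₁) x₂) ¬y₁≤R)
    (≤-trans (x⊗y≤x (¬ y₁) (¬ y₂)) ¬y₁≤R)
    where
      ¬y₁≤R : ¬ y₁ ≤ (x₁ ∧ x₂) ∨ ¬ (y₁ ∧ y₂)
      ¬y₁≤R = ≤-trans (¬-antitone (x∧y≤x y₁ y₂)) (y≤x∨y _ _)
      ¬y₂≤R : ¬ y₂ ≤ (x₁ ∧ x₂) ∨ ¬ (y₁ ∧ y₂)
      ¬y₂≤R = ≤-trans (¬-antitone (x∧y≤y y₁ y₂)) (y≤x∨y _ _)

module GoodSequences {c : Level} (L : BLAlgebra c) where
  open BLAlgebra L
  open BLProperties L

  EventuallyZero : Seq → Set c
  EventuallyZero a = ∃ λ n → ∀ r → n ≤ℕ r → a r ≡ 𝟘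

  zipWith-eventuallyZero : (_∙_ : Carrier → Carrier → Carrier) → 𝟘 ∙ 𝟘 ≡ 𝟘
    → ∀ {a b} → EventuallyZero a → EventuallyZero b → EventuallyZero (λ i → a i ∙ b i)
  zipWith-eventuallyZero _∙_ 𝟘∙𝟘≡𝟘 (n₁ , a≡𝟘) (n₂ , b≡𝟘) = n₁ ⊔ n₂ , λ r n≤r →
    trans (cong₂ _∙_ (a≡𝟘 r (≤ℕ-trans (m≤m⊔n n₁ n₂) n≤r)) (b≡𝟘 r (≤ℕ-trans (m≤n⊔m n₁ n₂) n≤r)))
          𝟘∙𝟘≡𝟘

  zipWith-good : (_∙_ : Carrier → Carrier → Carrier) → 𝟘 ∙ 𝟘 ≡ 𝟘
    → (∀ {x₁ y₁ x₂ y₂} → Covers x₁ y₁ → Covers x₂ y₂ → Covers (x₁ ∙ x₂) (y₁ ∙ y₂))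
    → ∀ {a b} → IsGood a → IsGood b → IsGood (λ i → a i ∙ b i)
  zipWith-good _∙_ 𝟘∙𝟘≡𝟘 preserves (a-steps , a-finite) (b-steps , b-finite) =
    (λ i → covers⇒absorbs (preserves (absorbs⇒covers (a-steps i)) (absorbs⇒covers (b-steps i))))
    , zipWith-eventuallyZero _∙_ 𝟘∙𝟘≡𝟘 a-finite b-finite

  ≤M-isPartialOrder : IsPartialOrder _≈M_ _≤M_
  ≤M-isPartialOrder = record
    { isPreorder = record
      { isEquivalence = record
        { refl = λ i → refl ; sym = λ a≈b i → sym (a≈b i) ; trans = λ a≈b b≈d i → trans (a≈b i) (b≈d i) }
      ; reflexive = λ a≈b i → reflexive (a≈b i)
      ; trans = λ a≤b b≤d i → ≤-trans (a≤b i) (b≤d i)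
      }
    ; antisym = λ a≤b b≤a i → antisym (a≤b i) (b≤a i)
    }

proposition5p1 : ∀ {c : Level} (L : BLAlgebra c) → let open BLAlgebra L in
    IsPartialOrder _≈M_ _≤M_
    × (∀ (a b : M) →
         Σ (IsGood (proj₁ a ∨ₛ proj₁ b)) (λ g → IsSupM a b ((proj₁ a ∨ₛ proj₁ b) , g))
       × Σ (IsGood (proj₁ a ∧ₛ proj₁ b)) (λ g → IsInfM a b ((proj₁ a ∧ₛ proj₁ b) , g)))
proposition5p1 L = ≤M-isPartialOrder , λ a b → join a b , meet a b
  where
    open BLAlgebra L
    open BLProperties L
    open GoodSequences L

    join : ∀ a b → Σ (IsGood (proj₁ a ∨ₛ proj₁ b)) (λ g → IsSupM a b ((proj₁ a ∨ₛ proj₁ b) , g))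
    join (a , a-good) (b , b-good) =
      zipWith-good _∨_ (∨-idem 𝟘) covers-∨ a-good b-good
      , (λ i → x≤x∨y (a i) (b i)) , (λ i → y≤x∨y (a i) (b i)) , λ _ a≤d b≤d i → ∨-least (a≤d i) (b≤d i)

    meet : ∀ a b → Σ (IsGood (proj₁ a ∧ₛ proj₁ b)) (λ g → IsInfM a b ((proj₁ a ∧ₛ proj₁ b) , g))
    meet (a , a-good) (b , b-good) =
      zipWith-good _∧_ (∧-idem 𝟘) covers-∧ a-good b-good
      , (λ i → x∧y≤x (a i) (b i)) , (λ i → x∧y≤y (a i) (b i)) , λ _ d≤a d≤b i → ∧-greatest (d≤a i) (d≤b i)
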